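{- Let $K$ be a field with normalised discrete valuation $v$, valuation ring $\mathcal{O}_K$, uniformiser $\pi$ and perfect residue field $k$. Let $n\in\{2,3,4\}$ and let $\Phi$ be a critical genus one model of degree $n$. Then $\mathcal{C}_\Phi(K)=\emptyset$.
   Context: Degree 2 models are $(P,Q)$ with $P=lx^2+mxz+nz^2$, $Q=ax^4+bx^3z+cx^2z^2+dxz^3+ez^4$, defining $\mathcal{C}_{(P,Q)}:y^2+P(x,z)y=Q(x,z)$ in $\mathbb{P}(1,1,2)$; degree 3 models are ternary cubics $F$ with $\mathcal{C}_F=\{F=0\}\subset\mathbb{P}^2$; degree 4 models are pairs $(Q_1,Q_2)$ of quadratic forms in $x_1,\dots,x_4$ with $\mathcal{C}=\{Q_1=Q_2=0\}\subset\mathbb{P}^3$. Critical models (all with coefficients in $\mathcal{O}_K$): (a) $(P,Q)$ is critical if $v(l)\ge1$, $v(m)\ge1$, $v(n)\ge2$, $v(a)=1$, $v(b)\ge2$, $v(c)\ge2$, $v(d)\ge3$, $v(e)=3$. (b) A ternary cubic is critical if the valuations of its coefficients satisfy: $x^3$: $=0$; $y^3$: $=1$; $z^3$: $=2$; $x^2y$: $\ge1$; $xy^2$: $\ge1$; $x^2z$: $\ge1$; $xyz$: $\ge1$; $y^2z$: $\ge2$; $xz^2$: $\ge2$; $yz^2$: $\ge2$. (c) $(Q_1,Q_2)$ is critical if the reductions of $Q_1,Q_2$ mod $\pi$ are quadratic forms in $x_1,x_2$ only with no common root in $\mathbb{P}^1(\overline{k})$, and with $R_i(x_1,\dots,x_4)=\pi^{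 -1}Q_i(\pi x_1,\pi x_2,x_3,x_4)$, the reductions of $R_1,R_2$ mod $\pi$ are quadratic forms in $x_3,x_4$ only with no common root in $\mathbb{P}^1(\overline{k})$. -}

module Defs where

open import Level using (Level; _⊔_; Lift) renaming (suc to lsuc)
open import Algebra.Bundles using (CommutativeRing)
open import Data.Nat using (ℕ; zero; suc)
open import Data.Nat.Primality using (Prime)
open import Data.Integer as ℤ using (ℤ; +_)
open import Data.Product using (Σ; ∃; _×_; _,_; proj₁)
open import Data.Empty using (⊥)
open import Data.Unit using (⊤)
open import Relation.Nullary using (¬_)
open import Relation.Binary.PropositionalEquality using (_≡_; refl)

record Field (c ℓ : Level) : Set (lsuc (c ⊔ ℓ)) where
  field
    commutativeRing : CommutativeRing c ℓ
  open CommutativeRing commutativeRing public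
  field
    1≉0     : ¬ (1# ≈ 0#)
    inverse : ∀ x → ¬ (x ≈ 0#) → ∃ λ y → (x * y) ≈ 1#

  pow : Carrier → ℕ → Carrier
  pow x zero    = 1#
  pow x (suc n) = x * pow x n

  fromℕ : ℕ → Carrier
  fromℕ zero    = 0#
  fromℕ (suc n) = 1# + fromℕ n

data ℤ∞ : Set where
  fin : ℤ → ℤ∞
  ∞   : ℤ∞

_+∞_ : ℤ∞ → ℤ∞ → ℤ∞
fin a +∞ fin b = fin (a ℤ.+ b)
fin a +∞ ∞     = ∞
∞     +∞ _     = ∞

data _≤∞_ : ℤ∞ → ℤ∞ → Set where
  fin≤fin : ∀ {a b} → a ℤ.≤ b → fin a ≤∞ fin b
  _≤∞∞    : ∀ x → x ≤∞ ∞

min∞ : ℤ∞ → ℤ∞ → ℤ∞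
min∞ (fin a) (fin b) = fin (a ℤ.⊓ b)
min∞ (fin a) ∞       = fin a
min∞ ∞       y       = y

record DVField (c ℓ : Level) : Set (lsuc (c ⊔ ℓ)) where
  field
    K : Field c ℓ
  open Field K public
  field
    v      : Carrier → ℤ∞
    v-cong : ∀ {x y} → x ≈ y → v x ≡ v y
    v-∞⇒0  : ∀ x → v x ≡ ∞ → x ≈ 0#
    v-0    : v 0# ≡ ∞
    v-mul  : ∀ x y → v (x * y) ≡ (v x +∞ v y)
    v-add  : ∀ x y → min∞ (v x) (v y) ≤∞ v (x + y)
    π      : Carrier
    v-π    : v π ≡ fin (+ 1)

  _v≥_ : Carrier → ℕ → Set
  x v≥ n = fin (+ n) ≤∞ v x

  _v=_ : Carrier → ℕ → Set
  x v= n = v x ≡ fin (+ n)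

  Integral : Carrier → Set
  Integral x = x v≥ 0

  π≉0 : ¬ (π ≈ 0#)
  π≉0 p = fin≢∞ (Relation.Binary.PropositionalEquality.trans
                   (Relation.Binary.PropositionalEquality.sym v-π)
                   (Relation.Binary.PropositionalEquality.trans (v-cong p) v-0))
    where fin≢∞ : ∀ {a} → fin a ≡ ∞ → ⊥
          fin≢∞ ()

  π⁻¹ : Carrier
  π⁻¹ = proj₁ (inverse π π≉0)

module _ {c ℓ : Level} (F : DVField c ℓ) where
  open DVField F

  -- Perfect residue field k = O_K/πO_K: if k has characteristic a prime p
  -- (i.e. p·1 ∈ πO_K), then every element of k is a p-th power.
  -- (A field of characteristic 0 is always perfect.)
  PerfectResidueField : Set c
  PerfectResidueField =
    ∀ p → Prime p → fromℕ p v≥ 1 →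
    ∀ x → Integral x → ∃ λ y → Integral y × ((pow y p - x) v≥ 1)

  -- A field extension of the residue field k: a field L with a map
  -- φ : O_K → L which is a ring homomorphism on O_K with kernel πO_K.
  record ResidueExtension : Set (lsuc (c ⊔ ℓ)) where
    field
      L : Field c ℓ
    module L = Field L
    field
      φ      : Carrier → L.Carrier
      φ-cong : ∀ {x y} → x ≈ y → φ x L.≈ φ y
      φ-+    : ∀ x y → Integral x → Integral y → φ (x + y) L.≈ (φ x L.+ φ y)
      φ-*    : ∀ x y → Integral x → Integral y → φ (x * y) L.≈ (φ x L.* φ y)
      φ-1    : φ 1# L.≈ L.1#
      φ-ker  : ∀ x → Integral x → φ x L.≈ L.0# → x v≥ 1
      ker-φ  : ∀ x → x v≥ 1 → φ x L.≈ L.0#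

  -- The reductions mod π of two binary quadratic forms
  -- α x² + β xz + γ z² and α' x² + β' xz + γ' z² (coefficients in O_K)
  -- have no common root in P¹(k̄): no common root in P¹(L) for any field
  -- extension L of k.
  NoCommonRootMod : (α β γ α' β' γ' : Carrier) → Set (lsuc (c ⊔ ℓ))
  NoCommonRootMod α β γ α' β' γ' =
    (E : ResidueExtension) → let open ResidueExtension E in
    ∀ s t → ¬ (s L.≈ L.0# × t L.≈ L.0#) →
    ((φ α L.* (s L.* s)) L.+ (φ β L.* (s L.* t)) L.+ (φ γ L.* (t L.* t))) L.≈ L.0# →
    ((φ α' L.* (s L.* s)) L.+ (φ β' L.* (s L.* t)) L.+ (φ γ' L.* (t L.* t))) L.≈ L.0# →
    ⊥

  -- Degree 2: (P, Q), P = l x² + m xz + n z²,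
  -- Q = a x⁴ + b x³z + c x²z² + d xz³ + e z⁴;  C : y² + P(x,z) y = Q(x,z)
  -- in P(1,1,2).

  record Model2 : Set c where
    field l m n a b c' d e : Carrier

  evalP : Model2 → Carrier → Carrier → Carrier
  evalP Φ x z = (l * (x * x)) + (m * (x * z)) + (n * (z * z))
    where open Model2 Φ

  evalQ : Model2 → Carrier → Carrier → Carrier
  evalQ Φ x z = (a * pow x 4) + (b * (pow x 3 * z)) + (c' * (pow x 2 * pow z 2))
                + (d * (x * pow z 3)) + (e * pow z 4)
    where open Model2 Φ

  record Critical2 (Φ : Model2) : Set where
    open Model2 Φ
    field
      vl : l v≥ 1
      vm : m v≥ 1
      vn : n v≥ 2
      va : a v= 1
      vb : b v≥ 2
      vc : c' v≥ 2
      vd : d v≥ 3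
      ve : e v= 3

  HasPoint2 : Model2 → Set (c ⊔ ℓ)
  HasPoint2 Φ = ∃ λ x → ∃ λ y → ∃ λ z →
    ¬ (x ≈ 0# × y ≈ 0# × z ≈ 0#) ×
    (((y * y) + (evalP Φ x z * y)) ≈ evalQ Φ x z)

  -- Degree 3: ternary cubics; field cIJK is the coefficient of x^I y^J z^K.

  record Model3 : Set c where
    field c300 c030 c003 c210 c120 c201 c111 c021 c102 c012 : Carrier

  evalF : Model3 → Carrier → Carrier → Carrier → Carrier
  evalF Φ x y z =
    (c300 * pow x 3) + (c030 * pow y 3) + (c003 * pow z 3)
    + (c210 * (pow x 2 * y)) + (c120 * (x * pow y 2))
    + (c201 * (pow x 2 * z)) + (c111 * (x * (y * z)))
    + (c021 * (pow y 2 * z)) + (c102 * (x * pow z 2))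
    + (c012 * (y * pow z 2))
    where open Model3 Φ

  record Critical3 (Φ : Model3) : Set where
    open Model3 Φ
    field
      v300 : c300 v= 0
      v030 : c030 v= 1
      v003 : c003 v= 2
      v210 : c210 v≥ 1
      v120 : c120 v≥ 1
      v201 : c201 v≥ 1
      v111 : c111 v≥ 1
      v021 : c021 v≥ 2
      v102 : c102 v≥ 2
      v012 : c012 v≥ 2

  HasPoint3 : Model3 → Set (c ⊔ ℓ)
  HasPoint3 Φ = ∃ λ x → ∃ λ y → ∃ λ z →
    ¬ (x ≈ 0# × y ≈ 0# × z ≈ 0#) × (evalF Φ x y z ≈ 0#)

  -- Degree 4: pairs of quadratic forms in x₁,…,x₄; field qIJ (I ≤ J) is the
  -- coefficient of x_I x_J.

  record QuadForm : Set c where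
    field q11 q12 q13 q14 q22 q23 q24 q33 q34 q44 : Carrier

  evalQF : QuadForm → Carrier → Carrier → Carrier → Carrier → Carrier
  evalQF Q x₁ x₂ x₃ x₄ =
    (q11 * (x₁ * x₁)) + (q12 * (x₁ * x₂)) + (q13 * (x₁ * x₃)) + (q14 * (x₁ * x₄))
    + (q22 * (x₂ * x₂)) + (q23 * (x₂ * x₃)) + (q24 * (x₂ * x₄))
    + (q33 * (x₃ * x₃)) + (q34 * (x₃ * x₄)) + (q44 * (x₄ * x₄))
    where open QuadForm Q

  -- R(x₁,…,x₄) = π⁻¹ Q(π x₁, π x₂, x₃, x₄), written out coefficientwise
  rescale : QuadForm → QuadForm
  rescale Q = record
    { q11 = π * q11 ; q12 = π * q12 ; q22 = π * q22
    ; q13 = q13 ; q14 = q14 ; q23 = q23 ; q24 = q24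
    ; q33 = π⁻¹ * q33 ; q34 = π⁻¹ * q34 ; q44 = π⁻¹ * q44 }
    where open QuadForm Q

  IntegralQF : QuadForm → Set
  IntegralQF Q = Integral q11 × Integral q12 × Integral q13 × Integral q14
    × Integral q22 × Integral q23 × Integral q24
    × Integral q33 × Integral q34 × Integral q44
    where open QuadForm Q

  -- reduction mod π is a quadratic form in x₁, x₂ only
  RedIn12 : QuadForm → Set
  RedIn12 Q = (q13 v≥ 1) × (q14 v≥ 1) × (q23 v≥ 1) × (q24 v≥ 1)
    × (q33 v≥ 1) × (q34 v≥ 1) × (q44 v≥ 1)
    where open QuadForm Q

  -- reduction mod π is a quadratic form in x₃, x₄ only
  RedIn34 : QuadForm → Set
  RedIn34 Q = (q11 v≥ 1) × (q12 v≥ 1) × (q13 v≥ 1) × (q14 v≥ 1)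
    × (q22 v≥ 1) × (q23 v≥ 1) × (q24 v≥ 1)
    where open QuadForm Q

  record Model4 : Set c where
    field Q₁ Q₂ : QuadForm

  record Critical4 (Φ : Model4) : Set (lsuc (c ⊔ ℓ)) where
    open Model4 Φ
    module Q₁ = QuadForm Q₁
    module Q₂ = QuadForm Q₂
    R₁ = rescale Q₁
    R₂ = rescale Q₂
    module R₁ = QuadForm R₁
    module R₂ = QuadForm R₂
    field
      int₁ : IntegralQF Q₁
      int₂ : IntegralQF Q₂
      red₁ : RedIn12 Q₁
      red₂ : RedIn12 Q₂
      noRootQ : NoCommonRootMod Q₁.q11 Q₁.q12 Q₁.q22 Q₂.q11 Q₂.q12 Q₂.q22
      intR₁ : IntegralQF R₁
      intR₂ : IntegralQF R₂
      redR₁ : RedIn34 R₁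
      redR₂ : RedIn34 R₂
      noRootR : NoCommonRootMod R₁.q33 R₁.q34 R₁.q44 R₂.q33 R₂.q34 R₂.q44

  HasPoint4 : Model4 → Set (c ⊔ ℓ)
  HasPoint4 Φ = ∃ λ x₁ → ∃ λ x₂ → ∃ λ x₃ → ∃ λ x₄ →
    ¬ (x₁ ≈ 0# × x₂ ≈ 0# × x₃ ≈ 0# × x₄ ≈ 0#) ×
    (evalQF Q₁ x₁ x₂ x₃ x₄ ≈ 0#) × (evalQF Q₂ x₁ x₂ x₃ x₄ ≈ 0#)
    where open Model4 Φ

  Model : ℕ → Set c
  Model 2 = Model2
  Model 3 = Model3
  Model 4 = Model4
  Model _ = Lift c ⊥

  Critical : (n : ℕ) → Model n → Set (lsuc (c ⊔ ℓ))
  Critical 2 Φ = Lift (lsuc (c ⊔ ℓ)) (Critical2 Φ)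
  Critical 3 Φ = Lift (lsuc (c ⊔ ℓ)) (Critical3 Φ)
  Critical 4 Φ = Critical4 Φ
  Critical _ _ = Lift (lsuc (c ⊔ ℓ)) ⊥

  HasKPoint : (n : ℕ) → Model n → Set (c ⊔ ℓ)
  HasKPoint 2 Φ = HasPoint2 Φ
  HasKPoint 3 Φ = HasPoint3 Φ
  HasKPoint 4 Φ = HasPoint4 Φ
  HasKPoint _ _ = Lift (c ⊔ ℓ) ⊥

-- Scale a K-point to a primitive integral vector: all coordinates in O_K, not all in πO_K.
-- In degrees 3 and 2 the valuation conditions of a critical model then push the coordinates
-- into πO_K one at a time, each time by isolating a monomial whose coefficient has exact
-- valuation (degree 3: x, then y, then z; degree 2: y, x, then y ∈ π²O_K, then z, after
-- noting that y is integral over O_K), contradicting primitivity. In degree 4, if x₁ or x₂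
-- is a unit then (x̄₁ : x̄₂) is a common root of the reductions of Q₁ and Q₂ in the residue
-- field; otherwise (x₁/π, x₂/π, x₃, x₄) is integral and (x̄₃ : x̄₄) is a common root of the
-- reductions of R₁ and R₂.

module Submission where

open import Defs
open import Level using (Level; Lift; lift)
open import Algebra.Bundles using (CommutativeRing)
open import Data.Nat as ℕ using (ℕ; zero; suc; _≤_; z≤n; s≤s)
import Data.Nat.Properties as ℕP
open import Data.Integer as ℤ using (+_; -[1+_]; +≤+; -≤+)
import Data.Integer.Properties as ℤP
open import Data.Product using (∃; _×_; _,_; proj₁; proj₂)
open import Data.Sum using (_⊎_; inj₁; inj₂)
open import Data.Empty using (⊥; ⊥-elim)
open import Data.List using (List; []; _∷_; foldl; foldr; map)
open import Data.List.Relation.Unary.All as All using (All; []; _∷_)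
import Data.List.Relation.Unary.All.Properties as All
open import Data.List.Relation.Unary.Any using (here; there)
open import Data.List.Membership.Propositional using (_∈_; _─_)
open import Relation.Nullary using (¬_; Dec; yes; no)
open import Relation.Nullary.Decidable using (True; toWitness; _×-dec_)
open import Relation.Binary.PropositionalEquality as ≡ using (_≡_)

≤∞-refl : ∀ x → x ≤∞ x
≤∞-refl (fin a) = fin≤fin ℤP.≤-refl
≤∞-refl ∞       = ∞ ≤∞∞

≤∞-trans : ∀ {x y z} → x ≤∞ y → y ≤∞ z → x ≤∞ z
≤∞-trans (fin≤fin p) (fin≤fin q) = fin≤fin (ℤP.≤-trans p q)
≤∞-trans {x} _       (_ ≤∞∞)     = x ≤∞∞

≤∞-total : ∀ x y → x ≤∞ y ⊎ y ≤∞ x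
≤∞-total (fin a) (fin b) with ℤP.≤-total a b
... | inj₁ a≤b = inj₁ (fin≤fin a≤b)
... | inj₂ b≤a = inj₂ (fin≤fin b≤a)
≤∞-total x       ∞       = inj₁ (x ≤∞∞)
≤∞-total ∞       y       = inj₂ (y ≤∞∞)

_≤∞?_ : ∀ x y → Dec (x ≤∞ y)
fin a ≤∞? fin b with a ℤ.≤? b
... | yes a≤b = yes (fin≤fin a≤b)
... | no  a≰b = no λ { (fin≤fin a≤b) → a≰b a≤b }
x     ≤∞? ∞     = yes (x ≤∞∞)
∞     ≤∞? fin b = no λ ()

≰∞⇒≥∞ : ∀ {x y} → ¬ (x ≤∞ y) → y ≤∞ x
≰∞⇒≥∞ {x} {y} x≰y with ≤∞-total y x
... | inj₁ y≤x = y≤x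
... | inj₂ x≤y = ⊥-elim (x≰y x≤y)

≱1⇒≤0 : ∀ {x} → ¬ (fin (+ 1) ≤∞ x) → x ≤∞ fin (+ 0)
≱1⇒≤0 {fin (+ zero)}  _   = ≤∞-refl _
≱1⇒≤0 {fin (+ suc k)} x≱1 = ⊥-elim (x≱1 (fin≤fin (+≤+ (s≤s z≤n))))
≱1⇒≤0 {fin -[1+ k ]}  _   = fin≤fin -≤+
≱1⇒≤0 {∞}             x≱1 = ⊥-elim (x≱1 (_ ≤∞∞))

∞≤∞⇒≡∞ : ∀ {x} → ∞ ≤∞ x → x ≡ ∞
∞≤∞⇒≡∞ (_ ≤∞∞) = ≡.refl

min∞-glb : ∀ {x y z} → x ≤∞ y → x ≤∞ z → x ≤∞ min∞ y z
min∞-glb (fin≤fin p) (fin≤fin q) = fin≤fin (ℤP.⊓-glb p q)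
min∞-glb (fin≤fin p) (_ ≤∞∞)     = fin≤fin p
min∞-glb (_ ≤∞∞)     x≤z         = x≤z

+∞-mono-≤∞ : ∀ {a b c d} → a ≤∞ b → c ≤∞ d → (a +∞ c) ≤∞ (b +∞ d)
+∞-mono-≤∞ (fin≤fin p) (fin≤fin q) = fin≤fin (ℤP.+-mono-≤ p q)
+∞-mono-≤∞ (fin≤fin p) (_ ≤∞∞)     = _ ≤∞∞
+∞-mono-≤∞ (_ ≤∞∞)     _           = _ ≤∞∞

+∞-identityˡ : ∀ x → fin (+ 0) +∞ x ≡ x
+∞-identityˡ (fin a) = ≡.cong fin (ℤP.+-identityˡ a)
+∞-identityˡ ∞       = ≡.refl

fin-injective : ∀ {a b} → fin a ≡ fin b → a ≡ b
fin-injective ≡.refl = ≡.refl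

i≡i+i⇒i≡0 : ∀ i → i ≡ i ℤ.+ i → i ≡ + 0
i≡i+i⇒i≡0 (+ zero)  _ = ≡.refl
i≡i+i⇒i≡0 (+ suc n) e = ⊥-elim (ℕP.m+1+n≢m n (≡.sym (ℕP.suc-injective (ℤP.+-injective e))))
i≡i+i⇒i≡0 -[1+ n ]  e = ⊥-elim (ℕP.m≢1+m+n n (ℤP.-[1+-injective e))

i+i≡0⇒i≡0 : ∀ i → i ℤ.+ i ≡ + 0 → i ≡ + 0
i+i≡0⇒i≡0 (+ zero)  _  = ≡.refl
i+i≡0⇒i≡0 (+ suc n) ()
i+i≡0⇒i≡0 -[1+ n ]  ()

ℤ-+-cancelˡ-≤ : ∀ i {j k} → i ℤ.+ j ℤ.≤ i ℤ.+ k → j ℤ.≤ k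
ℤ-+-cancelˡ-≤ i {j} {k} p = ≡.subst₂ ℤ._≤_ (cancel j) (cancel k) (ℤP.+-monoʳ-≤ (ℤ.- i) p)
  where
  cancel : ∀ m → ℤ.- i ℤ.+ (i ℤ.+ m) ≡ m
  cancel m = ≡.trans (≡.sym (ℤP.+-assoc (ℤ.- i) i m))
               (≡.trans (≡.cong (ℤ._+ m) (ℤP.+-inverseˡ i)) (ℤP.+-identityˡ m))

module _ {c ℓ : Level} (F : DVField c ℓ) where
  open DVField F
  open import Algebra.Properties.Ring ring
    using (-1*x≈-x; -‿involutive; -‿+-comm; -‿distribˡ-*; -‿distribʳ-*; -0#≈0#)
  open import Algebra.Properties.CommutativeSemigroup +-commutativeSemigroup using (x∙yz≈y∙xz)
  open import Relation.Binary.Reasoning.Setoid setoid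
  open import Algebra.Solver.Ring.NaturalCoefficients.Default commutativeSemiring

  v≥-cong : ∀ {x y n} → x ≈ y → x v≥ n → y v≥ n
  v≥-cong {n = n} x≈y = ≡.subst (fin (+ n) ≤∞_) (v-cong x≈y)

  v≡∞⇒v≥ : ∀ {x} n → v x ≡ ∞ → x v≥ n
  v≡∞⇒v≥ n vx≡∞ = ≡.subst (fin (+ n) ≤∞_) (≡.sym vx≡∞) (_ ≤∞∞)

  ≈0⇒v≥ : ∀ {x} n → x ≈ 0# → x v≥ n
  ≈0⇒v≥ n x≈0 = v≡∞⇒v≥ n (≡.trans (v-cong x≈0) v-0)

  v=⇒v≥ : ∀ {x n} → x v= n → x v≥ n
  v=⇒v≥ {x} {n} vx≡n = ≡.subst (fin (+ n) ≤∞_) (≡.sym vx≡n) (≤∞-refl _)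

  _v≥?_ : ∀ x n → Dec (x v≥ n)
  x v≥? n = fin (+ n) ≤∞? v x

  ≈0? : ∀ x → Dec (x ≈ 0#)
  ≈0? x with v x in vx
  ... | ∞     = yes (v-∞⇒0 x vx)
  ... | fin a = no λ x≈0 → fin≢∞ (≡.trans (≡.sym vx) (≡.trans (v-cong x≈0) v-0))
    where
    fin≢∞ : ¬ (fin a ≡ ∞)
    fin≢∞ ()

  v≥-weaken : ∀ {x m} n → x v≥ m → {True (n ℕ.≤? m)} → x v≥ n
  v≥-weaken {m = m} n x≥m {n≤m} = ≤∞-trans (fin≤fin (+≤+ (toWitness {a? = n ℕ.≤? m} n≤m))) x≥m

  v≥-+ : ∀ {x y n} → x v≥ n → y v≥ n → (x + y) v≥ n
  v≥-+ {x} {y} x≥n y≥n = ≤∞-trans (min∞-glb x≥n y≥n) (v-add x y)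

  v≥-* : ∀ {x y m n} → x v≥ m → y v≥ n → (x * y) v≥ (m ℕ.+ n)
  v≥-* {x} {y} {m} {n} x≥m y≥n =
    ≡.subst (fin (+ (m ℕ.+ n)) ≤∞_) (≡.sym (v-mul x y)) (+∞-mono-≤∞ x≥m y≥n)

  v-1# : v 1# ≡ fin (+ 0)
  v-1# = idempotent (v 1#) (≡.trans (≡.sym (v-cong (*-identityˡ 1#))) (v-mul 1# 1#))
                    (λ v1≡∞ → 1≉0 (v-∞⇒0 1# v1≡∞))
    where
    idempotent : ∀ w → w ≡ w +∞ w → ¬ (w ≡ ∞) → w ≡ fin (+ 0)
    idempotent (fin a) w≡w+w _   = ≡.cong fin (i≡i+i⇒i≡0 a (fin-injective w≡w+w))
    idempotent ∞       _     w≢∞ = ⊥-elim (w≢∞ ≡.refl)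

  1#-integral : Integral 1#
  1#-integral = ≡.subst (fin (+ 0) ≤∞_) (≡.sym v-1#) (≤∞-refl _)

  1#-v≱1 : ¬ (1# v≥ 1)
  1#-v≱1 1≥1 with ≡.subst (fin (+ 1) ≤∞_) v-1# 1≥1
  ... | fin≤fin (+≤+ ())

  v-[-1#] : v (- 1#) ≡ fin (+ 0)
  v-[-1#] = halve (v (- 1#)) (≡.trans (≡.sym (v-mul (- 1#) (- 1#))) (≡.trans (v-cong [-1]²≈1) v-1#))
    where
    [-1]²≈1 : - 1# * - 1# ≈ 1#
    [-1]²≈1 = trans (-1*x≈-x (- 1#)) (-‿involutive 1#)
    halve : ∀ w → w +∞ w ≡ fin (+ 0) → w ≡ fin (+ 0)
    halve (fin a) w+w≡0 = ≡.cong fin (i+i≡0⇒i≡0 a (fin-injective w+w≡0))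
    halve ∞       ()

  v-neg : ∀ x → v (- x) ≡ v x
  v-neg x = ≡.trans (v-cong (sym (-1*x≈-x x)))
              (≡.trans (v-mul (- 1#) x) (≡.trans (≡.cong (_+∞ v x) v-[-1#]) (+∞-identityˡ (v x))))

  v≥-neg : ∀ {x n} → x v≥ n → (- x) v≥ n
  v≥-neg {x} {n} = ≡.subst (fin (+ n) ≤∞_) (≡.sym (v-neg x))

  v≥-cancelˡ : ∀ {x y n} → (x + y) v≥ n → x v≥ n → y v≥ n
  v≥-cancelˡ {x} {y} x+y≥n x≥n = v≥-cong x+y-x≈y (v≥-+ x+y≥n (v≥-neg x≥n))
    where
    x+y-x≈y : (x + y) - x ≈ y
    x+y-x≈y = begin
      (x + y) - x  ≈⟨ +-cong (+-comm x y) refl ⟩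
      (y + x) - x  ≈⟨ +-assoc y x (- x) ⟩
      y + (x - x)  ≈⟨ +-cong refl (-‿inverseʳ x) ⟩
      y + 0#       ≈⟨ +-identityʳ y ⟩
      y            ∎

  v≥-cancelʳ : ∀ {x y n} → (x + y) v≥ n → y v≥ n → x v≥ n
  v≥-cancelʳ {x} {y} x+y≥n = v≥-cancelˡ (v≥-cong (+-comm x y) x+y≥n)

  v≥-pow : ∀ {x m} j → x v≥ m → pow x j v≥ (j ℕ.* m)
  v≥-pow zero    _   = 1#-integral
  v≥-pow (suc j) x≥m = v≥-* x≥m (v≥-pow j x≥m)

  v-pow : ∀ {x k} j → v x ≡ fin (+ k) → v (pow x j) ≡ fin (+ (j ℕ.* k))
  v-pow         zero    _    = v-1#
  v-pow {x} {k} (suc j) vx≡k = ≡.trans (v-mul x (pow x j)) (≡.cong₂ _+∞_ vx≡k (v-pow j vx≡k))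

  v≥-*-cancelˡ : ∀ {a x k r} → v a ≡ fin (+ k) → (a * x) v≥ (k ℕ.+ r) → x v≥ r
  v≥-*-cancelˡ {a} {x} {k} {r} va≡k ax≥k+r with v x in vx
  ... | ∞     = _ ≤∞∞
  ... | fin b with ≡.subst (fin (+ (k ℕ.+ r)) ≤∞_) (≡.trans (v-mul a x) (≡.cong₂ _+∞_ va≡k vx)) ax≥k+r
  ...   | fin≤fin k+r≤k+b = fin≤fin (ℤ-+-cancelˡ-≤ (+ k) k+r≤k+b)

  v≥-pow-root : ∀ {x m} j → x v≥ m → pow x (suc j) v≥ (suc j ℕ.* m ℕ.+ 1) → x v≥ suc m
  v≥-pow-root {x} {m} j x≥m xʲ⁺¹≥ with v x in vx | x≥m
  ... | ∞              | _                  = _ ≤∞∞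
  ... | fin -[1+ _ ]   | fin≤fin ()
  ... | fin (+ k)      | fin≤fin (+≤+ m≤k) with m ℕ.≟ k
  ...   | no m≢k    = fin≤fin (+≤+ (ℕP.≤∧≢⇒< m≤k m≢k))
  ...   | yes ≡.refl with ≡.subst (fin (+ (suc j ℕ.* m ℕ.+ 1)) ≤∞_) (v-pow (suc j) vx) xʲ⁺¹≥
  ...     | fin≤fin (+≤+ q) = ⊥-elim (ℕP.<⇒≱ (ℕP.m<m+n (suc j ℕ.* m) (s≤s z≤n)) q)

  pow-cong : ∀ {x y} j → x ≈ y → pow x j ≈ pow y j
  pow-cong zero    _   = refl
  pow-cong (suc j) x≈y = *-cong x≈y (pow-cong j x≈y)

  sum : List Carrier → Carrier
  sum = foldr _+_ 0#

  -- evalF, evalQ and evalQF are, definitionally, sumˡ of their lists of monomials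
  sumˡ : List Carrier → Carrier
  sumˡ []       = 0#
  sumˡ (t ∷ ts) = foldl _+_ t ts

  foldl-+≈+sum : ∀ t ts → foldl _+_ t ts ≈ t + sum ts
  foldl-+≈+sum t []       = sym (+-identityʳ t)
  foldl-+≈+sum t (s ∷ ts) = trans (foldl-+≈+sum (t + s) ts) (+-assoc t s (sum ts))

  sumˡ≈sum : ∀ ts → sumˡ ts ≈ sum ts
  sumˡ≈sum []       = refl
  sumˡ≈sum (t ∷ ts) = foldl-+≈+sum t ts

  sum-v≥ : ∀ {ts n} → All (_v≥ n) ts → sum ts v≥ n
  sum-v≥ []         = ≈0⇒v≥ _ refl
  sum-v≥ (t≥n ∷ ts≥n) = v≥-+ t≥n (sum-v≥ ts≥n)

  sum-─ : ∀ {t} ts (t∈ts : t ∈ ts) → sum ts ≈ t + sum (ts ─ t∈ts)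
  sum-─ (_ ∷ ts) (here ≡.refl) = refl
  sum-─ (s ∷ ts) (there t∈ts)  = trans (+-cong refl (sum-─ ts t∈ts)) (x∙yz≈y∙xz s _ _)

  v≥-isolate : ∀ {t n} ts (t∈ts : t ∈ ts) → sum ts v≥ n → All (_v≥ n) (ts ─ t∈ts) → t v≥ n
  v≥-isolate ts t∈ts ts≥n rest≥n = v≥-cancelʳ (v≥-cong (sum-─ ts t∈ts) ts≥n) (sum-v≥ rest≥n)

  integral-*-inverse : ∀ {u w x} → u * w ≈ 1# → v u ≤∞ v x → Integral (x * w)
  integral-*-inverse {u} {w} {x} uw≈1 u≤x =
    ≡.subst (fin (+ 0) ≤∞_) (≡.sym (v-mul x w))
      (≡.subst (_≤∞ (v x +∞ v w)) vu+vw≡0 (+∞-mono-≤∞ u≤x (≤∞-refl (v w))))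
    where
    vu+vw≡0 : v u +∞ v w ≡ fin (+ 0)
    vu+vw≡0 = ≡.trans (≡.sym (v-mul u w)) (≡.trans (v-cong uw≈1) v-1#)

  ≈0-v≤⇒≈0 : ∀ {u x} → u ≈ 0# → v u ≤∞ v x → x ≈ 0#
  ≈0-v≤⇒≈0 {u} {x} u≈0 u≤x =
    v-∞⇒0 x (∞≤∞⇒≡∞ (≡.subst (_≤∞ v x) (≡.trans (v-cong u≈0) v-0) u≤x))

  x*y≈0⇒y≈0 : ∀ {x y} → ¬ (x ≈ 0#) → x * y ≈ 0# → y ≈ 0#
  x*y≈0⇒y≈0 {x} {y} x≉0 xy≈0 with inverse x x≉0
  ... | x⁻¹ , xx⁻¹≈1 = begin
    y               ≈⟨ *-identityˡ y ⟨
    1# * y          ≈⟨ *-cong (trans (*-comm x⁻¹ x) xx⁻¹≈1) refl ⟨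
    (x⁻¹ * x) * y   ≈⟨ *-assoc x⁻¹ x y ⟩
    x⁻¹ * (x * y)   ≈⟨ *-cong refl xy≈0 ⟩
    x⁻¹ * 0#        ≈⟨ zeroʳ x⁻¹ ⟩
    0#              ∎

  y*y≈0⇒y≈0 : ∀ {y} → y * y ≈ 0# → y ≈ 0#
  y*y≈0⇒y≈0 {y} yy≈0 with ≈0? y
  ... | yes y≈0 = y≈0
  ... | no  y≉0 = x*y≈0⇒y≈0 y≉0 yy≈0

  -- Primitive representatives of points

  Primitive : List Carrier → Set c
  Primitive xs = All Integral xs × ¬ All (_v≥ 1) xs

  minimal-valuation : ∀ x xs → ∃ λ u → u ∈ x ∷ xs × All (λ y → v u ≤∞ v y) (x ∷ xs)
  minimal-valuation x []       = x , here ≡.refl , ≤∞-refl _ ∷ []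
  minimal-valuation x (y ∷ ys) with minimal-valuation y ys
  ... | u , u∈ , u≤ with ≤∞-total (v x) (v u)
  ...   | inj₁ x≤u = x , here ≡.refl , ≤∞-refl _ ∷ All.map (≤∞-trans x≤u) u≤
  ...   | inj₂ u≤x = u , there u∈ , u≤x ∷ u≤

  primitive-multiple : ∀ xs → ¬ All (_≈ 0#) xs → ∃ λ w → Primitive (map (_* w) xs)
  primitive-multiple []       xs≉0 = ⊥-elim (xs≉0 [])
  primitive-multiple (x ∷ xs) xs≉0 with minimal-valuation x xs
  ... | u , u∈ , u≤ with inverse u (λ u≈0 → xs≉0 (All.map (≈0-v≤⇒≈0 u≈0) u≤))
  ...   | w , uw≈1 =
    w , All.map⁺ (All.map (integral-*-inverse uw≈1) u≤)
      , λ xsw≥1 → 1#-v≱1 (v≥-cong uw≈1 (All.lookup (All.map⁻ xsw≥1) u∈))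

  monic-root-integral : ∀ {p q y} → Integral p → Integral q → y * y + p * y ≈ q → Integral y
  -- if v y < 0 then y = q y⁻¹ - p would be integral
  monic-root-integral {p} {q} {y} p≥0 q≥0 y²+py≈q with y v≥? 0
  ... | yes y≥0 = y≥0
  ... | no  y≱0 with inverse y (λ y≈0 → y≱0 (≈0⇒v≥ 0 y≈0))
  ...   | s , ys≈1 = ⊥-elim (y≱0 (v≥-cancelʳ (v≥-cong qs≈y+p (v≥-* q≥0 s≥0)) p≥0))
    where
    s≥0 : Integral s
    s≥0 = v≥-cong (*-identityˡ s)
            (integral-*-inverse ys≈1 (≡.subst (v y ≤∞_) (≡.sym v-1#) (≰∞⇒≥∞ y≱0)))
    qs≈y+p : q * s ≈ y + p
    qs≈y+p = begin
      q * s                  ≈⟨ *-cong y²+py≈q refl ⟨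
      (y * y + p * y) * s    ≈⟨ solve 3 (λ Y P S → (Y :* Y :+ P :* Y) :* S := (Y :+ P) :* (Y :* S))
                                  refl y p s ⟩
      (y + p) * (y * s)      ≈⟨ *-cong refl ys≈1 ⟩
      (y + p) * 1#           ≈⟨ *-identityʳ (y + p) ⟩
      y + p                  ∎

  binary : Carrier → Carrier → Carrier → Carrier → Carrier → Carrier
  binary α β γ s t = α * (s * s) + β * (s * t) + γ * (t * t)

  -- The residue field

  module ResidueField where

    𝒪 : Set c
    𝒪 = ∃ Integral

    infix 4 _≋_
    record _≋_ (a b : 𝒪) : Set ℓ where
      constructor ≋-intro
      field ≋-elim : Lift ℓ ((proj₁ a - proj₁ b) v≥ 1)

    infixl 6 _+ₒ_
    infixl 7 _*ₒ_

    _+ₒ_ _*ₒ_ : 𝒪 → 𝒪 → 𝒪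
    (a , a≥0) +ₒ (b , b≥0) = a + b , v≥-+ a≥0 b≥0
    (a , a≥0) *ₒ (b , b≥0) = a * b , v≥-* a≥0 b≥0

    -ₒ_ : 𝒪 → 𝒪
    -ₒ (a , a≥0) = - a , v≥-neg a≥0

    0ₒ 1ₒ : 𝒪
    0ₒ = 0# , ≈0⇒v≥ 0 refl
    1ₒ = 1# , 1#-integral

    ≈⇒≋ : ∀ {a b : 𝒪} → proj₁ a ≈ proj₁ b → a ≋ b
    ≈⇒≋ {a , _} {b , _} a≈b = ≋-intro (lift (≈0⇒v≥ 1 (trans (+-cong a≈b refl) (-‿inverseʳ b))))

    ≋-refl : ∀ {a} → a ≋ a
    ≋-refl = ≈⇒≋ refl

    ≋-sym : ∀ {a b} → a ≋ b → b ≋ a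
    ≋-sym {a , _} {b , _} (≋-intro (lift a-b≥1)) = ≋-intro (lift (v≥-cong -[a-b]≈b-a (v≥-neg a-b≥1)))
      where
      -[a-b]≈b-a : - (a - b) ≈ b - a
      -[a-b]≈b-a = begin
        - (a - b)     ≈⟨ -‿+-comm a (- b) ⟨
        - a + - (- b) ≈⟨ +-cong refl (-‿involutive b) ⟩
        - a + b       ≈⟨ +-comm (- a) b ⟩
        b - a         ∎

    ≋-trans : ∀ {a b d} → a ≋ b → b ≋ d → a ≋ d
    ≋-trans {a , _} {b , _} {d , _} (≋-intro (lift a-b≥1)) (≋-intro (lift b-d≥1)) =
      ≋-intro (lift (v≥-cong telescope (v≥-+ a-b≥1 b-d≥1)))
      where
      telescope : (a - b) + (b - d) ≈ a - d
      telescope = begin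
        (a - b) + (b - d)   ≈⟨ solve 4 (λ A -B B -D → (A :+ -B) :+ (B :+ -D) := (A :+ -D) :+ (B :+ -B))
                                 refl a (- b) b (- d) ⟩
        (a - d) + (b - b)   ≈⟨ +-cong refl (-‿inverseʳ b) ⟩
        (a - d) + 0#        ≈⟨ +-identityʳ (a - d) ⟩
        a - d               ∎

    +ₒ-cong : ∀ {a a' b b'} → a ≋ a' → b ≋ b' → a +ₒ b ≋ a' +ₒ b'
    +ₒ-cong {a , _} {a' , _} {b , _} {b' , _} (≋-intro (lift a-a'≥1)) (≋-intro (lift b-b'≥1)) =
      ≋-intro (lift (v≥-cong regroup (v≥-+ a-a'≥1 b-b'≥1)))
      where
      regroup : (a - a') + (b - b') ≈ (a + b) - (a' + b')
      regroup = begin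
        (a - a') + (b - b')     ≈⟨ solve 4 (λ A -A' B -B' → (A :+ -A') :+ (B :+ -B')
                                                         := (A :+ B) :+ (-A' :+ -B'))
                                     refl a (- a') b (- b') ⟩
        (a + b) + (- a' + - b') ≈⟨ +-cong refl (-‿+-comm a' b') ⟩
        (a + b) - (a' + b')     ∎

    *ₒ-cong : ∀ {a a' b b'} → a ≋ a' → b ≋ b' → a *ₒ b ≋ a' *ₒ b'
    *ₒ-cong {a , a≥0} {a' , _} {b , _} {b' , b'≥0} (≋-intro (lift a-a'≥1)) (≋-intro (lift b-b'≥1)) =
      ≋-intro (lift (v≥-cong regroup (v≥-+ (v≥-* a≥0 b-b'≥1) (v≥-* a-a'≥1 b'≥0))))
      where
      regroup : a * (b - b') + (a - a') * b' ≈ a * b - a' * b'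
      regroup = begin
        a * (b + - b') + (a + - a') * b'
          ≈⟨ solve 5 (λ A B -B' -A' B' → A :* (B :+ -B') :+ (A :+ -A') :* B'
                                       := (A :* B :+ -A' :* B') :+ (A :* -B' :+ A :* B'))
               refl a b (- b') (- a') b' ⟩
        (a * b + - a' * b') + (a * - b' + a * b')
          ≈⟨ +-cong (+-cong refl (-‿distribˡ-* a' b')) (+-cong (-‿distribʳ-* a b') refl) ⟨
        (a * b + - (a' * b')) + (- (a * b') + a * b')
          ≈⟨ +-cong refl (-‿inverseˡ (a * b')) ⟩
        (a * b - a' * b') + 0#
          ≈⟨ +-identityʳ _ ⟩
        a * b - a' * b'
          ∎

    -ₒ-cong : ∀ {a a'} → a ≋ a' → -ₒ a ≋ -ₒ a'
    -ₒ-cong {a , _} {a' , _} (≋-intro (lift a-a'≥1)) =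
      ≋-intro (lift (v≥-cong (sym (-‿+-comm a (- a'))) (v≥-neg a-a'≥1)))

    ≋0⇒v≥1 : ∀ {a} → a ≋ 0ₒ → proj₁ a v≥ 1
    ≋0⇒v≥1 {a , _} (≋-intro (lift a-0≥1)) = v≥-cong (trans (+-cong refl -0#≈0#) (+-identityʳ a)) a-0≥1

    v≥1⇒≋0 : ∀ {a} → proj₁ a v≥ 1 → a ≋ 0ₒ
    v≥1⇒≋0 {a , _} a≥1 = ≋-intro (lift (v≥-cong (sym (trans (+-cong refl -0#≈0#) (+-identityʳ a))) a≥1))

    residueRing : CommutativeRing c ℓ
    residueRing = record
      { Carrier = 𝒪 ; _≈_ = _≋_ ; _+_ = _+ₒ_ ; _*_ = _*ₒ_ ; -_ = -ₒ_ ; 0# = 0ₒ ; 1# = 1ₒ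
      ; isCommutativeRing = record
        { isRing = record
          { +-isAbelianGroup = record
            { isGroup = record
              { isMonoid = record
                { isSemigroup = record
                  { isMagma = record
                    { isEquivalence = record { refl = ≋-refl ; sym = ≋-sym ; trans = ≋-trans }
                    ; ∙-cong = +ₒ-cong }
                  ; assoc = λ _ _ _ → ≈⇒≋ (+-assoc _ _ _) }
                ; identity = (λ _ → ≈⇒≋ (+-identityˡ _)) , (λ _ → ≈⇒≋ (+-identityʳ _)) }
              ; inverse = (λ _ → ≈⇒≋ (-‿inverseˡ _)) , (λ _ → ≈⇒≋ (-‿inverseʳ _))
              ; ⁻¹-cong = -ₒ-cong }
            ; comm = λ _ _ → ≈⇒≋ (+-comm _ _) }
          ; *-cong = *ₒ-cong
          ; *-assoc = λ _ _ _ → ≈⇒≋ (*-assoc _ _ _)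
          ; *-identity = (λ _ → ≈⇒≋ (*-identityˡ _)) , (λ _ → ≈⇒≋ (*-identityʳ _))
          ; distrib = (λ _ _ _ → ≈⇒≋ (distribˡ _ _ _)) , (λ _ _ _ → ≈⇒≋ (distribʳ _ _ _)) }
        ; *-comm = λ _ _ → ≈⇒≋ (*-comm _ _) } }

    inverseₒ : ∀ a → ¬ (a ≋ 0ₒ) → ∃ λ b → a *ₒ b ≋ 1ₒ
    inverseₒ (a , a≥0) a≉0 with inverse a (λ a≈0 → a≉0 (v≥1⇒≋0 (≈0⇒v≥ 1 a≈0)))
    ... | b , ab≈1 = (b , b≥0) , ≈⇒≋ ab≈1
      where
      va≤v1 : v a ≤∞ v 1#
      va≤v1 = ≡.subst (v a ≤∞_) (≡.sym v-1#) (≱1⇒≤0 (λ a≥1 → a≉0 (v≥1⇒≋0 a≥1)))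
      b≥0 : Integral b
      b≥0 = v≥-cong (*-identityˡ b) (integral-*-inverse ab≈1 va≤v1)

    residueField : Field c ℓ
    residueField = record
      { commutativeRing = residueRing
      ; 1≉0 = λ 1≋0 → 1#-v≱1 (≋0⇒v≥1 1≋0)
      ; inverse = inverseₒ }

    -- φ must be total; outside O_K it takes the junk value 0ₒ
    reduce : Carrier → 𝒪
    reduce x with x v≥? 0
    ... | yes x≥0 = x , x≥0
    ... | no  _   = 0ₒ

    reduce-integral : ∀ {x} (x≥0 : Integral x) → reduce x ≋ (x , x≥0)
    reduce-integral {x} x≥0 with x v≥? 0
    ... | yes _   = ≈⇒≋ refl
    ... | no  x≱0 = ⊥-elim (x≱0 x≥0)

    reduce-nonintegral : ∀ {x} → ¬ Integral x → reduce x ≋ 0ₒ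
    reduce-nonintegral {x} x≱0 with x v≥? 0
    ... | yes x≥0 = ⊥-elim (x≱0 x≥0)
    ... | no  _   = ≋-refl

    reduce-cong : ∀ {x y} → x ≈ y → reduce x ≋ reduce y
    reduce-cong {x} {y} x≈y = by-cases (x v≥? 0)
      where
      by-cases : Dec (Integral x) → reduce x ≋ reduce y
      by-cases (yes x≥0) = ≋-trans (reduce-integral x≥0)
                             (≋-trans (≈⇒≋ x≈y) (≋-sym (reduce-integral (v≥-cong x≈y x≥0))))
      by-cases (no x≱0)  = ≋-trans (reduce-nonintegral x≱0)
                             (≋-sym (reduce-nonintegral (λ y≥0 → x≱0 (v≥-cong (sym x≈y) y≥0))))

    residueExtension : ResidueExtension F
    residueExtension = record
      { L = residueField
      ; φ = reduce
      ; φ-cong = reduce-cong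
      ; φ-+ = λ x y x≥0 y≥0 → ≋-trans (reduce-integral (v≥-+ x≥0 y≥0))
                                (+ₒ-cong (≋-sym (reduce-integral x≥0)) (≋-sym (reduce-integral y≥0)))
      ; φ-* = λ x y x≥0 y≥0 → ≋-trans (reduce-integral (v≥-* x≥0 y≥0))
                                (*ₒ-cong (≋-sym (reduce-integral x≥0)) (≋-sym (reduce-integral y≥0)))
      ; φ-1 = reduce-integral 1#-integral
      ; φ-ker = λ x x≥0 x↦0 → ≋0⇒v≥1 (≋-trans (≋-sym (reduce-integral x≥0)) x↦0)
      ; ker-φ = λ x x≥1 → ≋-trans (reduce-integral (v≥-weaken 0 x≥1)) (v≥1⇒≋0 x≥1) }

    reduce-binary : ∀ {α β γ s t} → Integral α → Integral β → Integral γ → Integral s → Integral t →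
      binary α β γ s t v≥ 1 →
      reduce α *ₒ (reduce s *ₒ reduce s) +ₒ reduce β *ₒ (reduce s *ₒ reduce t)
        +ₒ reduce γ *ₒ (reduce t *ₒ reduce t) ≋ 0ₒ
    reduce-binary {s = s} {t} α≥0 β≥0 γ≥0 s≥0 t≥0 binary≥1 =
      ≋-trans (+ₒ-cong (+ₒ-cong (*ₒ-cong (reduce-integral α≥0) (*ₒ-cong s̄ s̄))
                                (*ₒ-cong (reduce-integral β≥0) (*ₒ-cong s̄ t̄)))
                       (*ₒ-cong (reduce-integral γ≥0) (*ₒ-cong t̄ t̄)))
              (v≥1⇒≋0 binary≥1)
      where
      s̄ : reduce s ≋ (s , s≥0)
      s̄ = reduce-integral s≥0
      t̄ : reduce t ≋ (t , t≥0)
      t̄ = reduce-integral t≥0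

    reduce-nonzero : ∀ {s t} → Integral s → Integral t → ¬ (s v≥ 1 × t v≥ 1) →
      ¬ (reduce s ≋ 0ₒ × reduce t ≋ 0ₒ)
    reduce-nonzero s≥0 t≥0 ¬st≥1 (s↦0 , t↦0) =
      ¬st≥1 ( ≋0⇒v≥1 (≋-trans (≋-sym (reduce-integral s≥0)) s↦0)
            , ≋0⇒v≥1 (≋-trans (≋-sym (reduce-integral t≥0)) t↦0))

  -- Solver expressions shaped exactly like the forms in Defs, so that their semantics
  -- is definitionally the form being normalised.

  powᴾ : ∀ {k} → Polynomial k → ℕ → Polynomial k
  powᴾ X zero    = con 1
  powᴾ X (suc j) = X :* powᴾ X j

  binaryᴾ : ∀ {k} (α β γ S T : Polynomial k) → Polynomial k
  binaryᴾ α β γ S T = α :* (S :* S) :+ β :* (S :* T) :+ γ :* (T :* T)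

  cubicᴾ : ∀ {k} (c300 c030 c003 c210 c120 c201 c111 c021 c102 c012 X Y Z : Polynomial k) → Polynomial k
  cubicᴾ c300 c030 c003 c210 c120 c201 c111 c021 c102 c012 X Y Z =
    c300 :* powᴾ X 3 :+ c030 :* powᴾ Y 3 :+ c003 :* powᴾ Z 3
    :+ c210 :* (powᴾ X 2 :* Y) :+ c120 :* (X :* powᴾ Y 2)
    :+ c201 :* (powᴾ X 2 :* Z) :+ c111 :* (X :* (Y :* Z))
    :+ c021 :* (powᴾ Y 2 :* Z) :+ c102 :* (X :* powᴾ Z 2)
    :+ c012 :* (Y :* powᴾ Z 2)

  quarticᴾ : ∀ {k} (a b c d e X Z : Polynomial k) → Polynomial k
  quarticᴾ a b c d e X Z =
    a :* powᴾ X 4 :+ b :* (powᴾ X 3 :* Z) :+ c :* (powᴾ X 2 :* powᴾ Z 2)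
    :+ d :* (X :* powᴾ Z 3) :+ e :* powᴾ Z 4

  mixedᴾ : ∀ {k} (q13 q14 q23 q24 X₁ X₂ X₃ X₄ : Polynomial k) → Polynomial k
  mixedᴾ q13 q14 q23 q24 X₁ X₂ X₃ X₄ =
    q13 :* (X₁ :* X₃) :+ q14 :* (X₁ :* X₄) :+ q23 :* (X₂ :* X₃) :+ q24 :* (X₂ :* X₄)

  quadraticᴾ : ∀ {k} (q11 q12 q13 q14 q22 q23 q24 q33 q34 q44 X₁ X₂ X₃ X₄ : Polynomial k) → Polynomial k
  quadraticᴾ q11 q12 q13 q14 q22 q23 q24 q33 q34 q44 X₁ X₂ X₃ X₄ =
    q11 :* (X₁ :* X₁) :+ q12 :* (X₁ :* X₂) :+ q13 :* (X₁ :* X₃) :+ q14 :* (X₁ :* X₄)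
    :+ q22 :* (X₂ :* X₂) :+ q23 :* (X₂ :* X₃) :+ q24 :* (X₂ :* X₄)
    :+ q33 :* (X₃ :* X₃) :+ q34 :* (X₃ :* X₄) :+ q44 :* (X₄ :* X₄)

  -- Degree 3

  module _ (Φ : Model3 F) (critical : Critical3 F Φ) where
    open Model3 Φ
    open Critical3 critical

    cubic-monomials : Carrier → Carrier → Carrier → List Carrier
    cubic-monomials x y z =
      c300 * pow x 3 ∷ c030 * pow y 3 ∷ c003 * pow z 3 ∷ c210 * (pow x 2 * y) ∷ c120 * (x * pow y 2) ∷
      c201 * (pow x 2 * z) ∷ c111 * (x * (y * z)) ∷ c021 * (pow y 2 * z) ∷ c102 * (x * pow z 2) ∷
      c012 * (y * pow z 2) ∷ []

    evalF-homogeneous : ∀ x y z w → evalF F Φ (x * w) (y * w) (z * w) ≈ pow w 3 * evalF F Φ x y z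
    evalF-homogeneous = solve 14
      (λ a₁ a₂ a₃ a₄ a₅ a₆ a₇ a₈ a₉ a₁₀ X Y Z W →
        cubicᴾ a₁ a₂ a₃ a₄ a₅ a₆ a₇ a₈ a₉ a₁₀ (X :* W) (Y :* W) (Z :* W)
          := powᴾ W 3 :* cubicᴾ a₁ a₂ a₃ a₄ a₅ a₆ a₇ a₈ a₉ a₁₀ X Y Z)
      refl c300 c030 c003 c210 c120 c201 c111 c021 c102 c012

    module CubicDescent {x y z} (x≥0 : Integral x) (y≥0 : Integral y) (z≥0 : Integral z)
                        (F≈0 : evalF F Φ x y z ≈ 0#) where

      monomials-v≥ : ∀ n → sum (cubic-monomials x y z) v≥ n
      monomials-v≥ n = v≥-cong (sumˡ≈sum (cubic-monomials x y z)) (≈0⇒v≥ n F≈0)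

      x∈πO : x v≥ 1
      x∈πO = v≥-pow-root 2 x≥0 (v≥-*-cancelˡ v300
        (v≥-isolate (cubic-monomials x y z) (here ≡.refl) (monomials-v≥ 1)
          ( v≥-weaken 1 (v≥-* (v=⇒v≥ v030) (v≥-pow 3 y≥0))
          ∷ v≥-weaken 1 (v≥-* (v=⇒v≥ v003) (v≥-pow 3 z≥0))
          ∷ v≥-weaken 1 (v≥-* v210 (v≥-* (v≥-pow 2 x≥0) y≥0))
          ∷ v≥-weaken 1 (v≥-* v120 (v≥-* x≥0 (v≥-pow 2 y≥0)))
          ∷ v≥-weaken 1 (v≥-* v201 (v≥-* (v≥-pow 2 x≥0) z≥0))
          ∷ v≥-weaken 1 (v≥-* v111 (v≥-* x≥0 (v≥-* y≥0 z≥0)))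
          ∷ v≥-weaken 1 (v≥-* v021 (v≥-* (v≥-pow 2 y≥0) z≥0))
          ∷ v≥-weaken 1 (v≥-* v102 (v≥-* x≥0 (v≥-pow 2 z≥0)))
          ∷ v≥-weaken 1 (v≥-* v012 (v≥-* y≥0 (v≥-pow 2 z≥0)))
          ∷ [])))

      y∈πO : y v≥ 1
      y∈πO = v≥-pow-root 2 y≥0 (v≥-*-cancelˡ v030
        (v≥-isolate (cubic-monomials x y z) (there (here ≡.refl)) (monomials-v≥ 2)
          ( v≥-weaken 2 (v≥-* (v=⇒v≥ v300) (v≥-pow 3 x∈πO))
          ∷ v≥-weaken 2 (v≥-* (v=⇒v≥ v003) (v≥-pow 3 z≥0))
          ∷ v≥-weaken 2 (v≥-* v210 (v≥-* (v≥-pow 2 x∈πO) y≥0))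
          ∷ v≥-weaken 2 (v≥-* v120 (v≥-* x∈πO (v≥-pow 2 y≥0)))
          ∷ v≥-weaken 2 (v≥-* v201 (v≥-* (v≥-pow 2 x∈πO) z≥0))
          ∷ v≥-weaken 2 (v≥-* v111 (v≥-* x∈πO (v≥-* y≥0 z≥0)))
          ∷ v≥-weaken 2 (v≥-* v021 (v≥-* (v≥-pow 2 y≥0) z≥0))
          ∷ v≥-weaken 2 (v≥-* v102 (v≥-* x∈πO (v≥-pow 2 z≥0)))
          ∷ v≥-weaken 2 (v≥-* v012 (v≥-* y≥0 (v≥-pow 2 z≥0)))
          ∷ [])))

      z∈πO : z v≥ 1
      z∈πO = v≥-pow-root 2 z≥0 (v≥-*-cancelˡ v003
        (v≥-isolate (cubic-monomials x y z) (there (there (here ≡.refl))) (monomials-v≥ 3)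
          ( v≥-weaken 3 (v≥-* (v=⇒v≥ v300) (v≥-pow 3 x∈πO))
          ∷ v≥-weaken 3 (v≥-* (v=⇒v≥ v030) (v≥-pow 3 y∈πO))
          ∷ v≥-weaken 3 (v≥-* v210 (v≥-* (v≥-pow 2 x∈πO) y∈πO))
          ∷ v≥-weaken 3 (v≥-* v120 (v≥-* x∈πO (v≥-pow 2 y∈πO)))
          ∷ v≥-weaken 3 (v≥-* v201 (v≥-* (v≥-pow 2 x∈πO) z≥0))
          ∷ v≥-weaken 3 (v≥-* v111 (v≥-* x∈πO (v≥-* y∈πO z≥0)))
          ∷ v≥-weaken 3 (v≥-* v021 (v≥-* (v≥-pow 2 y∈πO) z≥0))
          ∷ v≥-weaken 3 (v≥-* v102 (v≥-* x∈πO (v≥-pow 2 z≥0)))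
          ∷ v≥-weaken 3 (v≥-* v012 (v≥-* y∈πO (v≥-pow 2 z≥0)))
          ∷ [])))

    critical3-no-point : ¬ HasPoint3 F Φ
    critical3-no-point (x , y , z , xyz≉0 , F≈0)
      with primitive-multiple (x ∷ y ∷ z ∷ []) (λ { (x≈0 ∷ y≈0 ∷ z≈0 ∷ []) → xyz≉0 (x≈0 , y≈0 , z≈0) })
    ... | w , (xw≥0 ∷ yw≥0 ∷ zw≥0 ∷ []) , ¬all≥1 = ¬all≥1 (x∈πO ∷ y∈πO ∷ z∈πO ∷ [])
      where
      open CubicDescent xw≥0 yw≥0 zw≥0
             (trans (evalF-homogeneous x y z w) (trans (*-cong refl F≈0) (zeroʳ (pow w 3))))

  -- Degree 2

  module _ (Φ : Model2 F) (critical : Critical2 F Φ) where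
    open Model2 Φ
    open Critical2 critical

    quartic-monomials : Carrier → Carrier → List Carrier
    quartic-monomials x z =
      a * pow x 4 ∷ b * (pow x 3 * z) ∷ c' * (pow x 2 * pow z 2) ∷ d * (x * pow z 3) ∷ e * pow z 4 ∷ []

    OnCurve : Carrier → Carrier → Carrier → Set ℓ
    OnCurve x y z = y * y + evalP F Φ x z * y ≈ evalQ F Φ x z

    on-curve-homogeneous : ∀ {x y z} w → OnCurve x y z → OnCurve (x * w) (y * (w * w)) (z * w)
    on-curve-homogeneous {x} {y} {z} w on-curve = begin
      y * (w * w) * (y * (w * w)) + evalP F Φ (x * w) (z * w) * (y * (w * w))
        ≈⟨ solve 7 (λ L M N X Y Z W →
             Y :* (W :* W) :* (Y :* (W :* W)) :+ binaryᴾ L M N (X :* W) (Z :* W) :* (Y :* (W :* W))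
               := powᴾ W 4 :* (Y :* Y :+ binaryᴾ L M N X Z :* Y))
             refl l m n x y z w ⟩
      pow w 4 * (y * y + evalP F Φ x z * y)
        ≈⟨ *-cong refl on-curve ⟩
      pow w 4 * evalQ F Φ x z
        ≈⟨ solve 8 (λ A B C D E X Z W →
             quarticᴾ A B C D E (X :* W) (Z :* W) := powᴾ W 4 :* quarticᴾ A B C D E X Z)
             refl a b c' d e x z w ⟨
      evalQ F Φ (x * w) (z * w)
        ∎

    evalP-origin : ∀ {x z} → x ≈ 0# → z ≈ 0# → evalP F Φ x z ≈ 0#
    evalP-origin {x} {z} x≈0 z≈0 = trans (+-cong (+-cong (*-cong refl (*-cong x≈0 x≈0))
                                                          (*-cong refl (*-cong x≈0 z≈0)))
                                                 (*-cong refl (*-cong z≈0 z≈0)))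
      (solve 3 (λ L M N → binaryᴾ L M N (con 0) (con 0) := con 0) refl l m n)

    evalQ-origin : ∀ {x z} → x ≈ 0# → z ≈ 0# → evalQ F Φ x z ≈ 0#
    evalQ-origin {x} {z} x≈0 z≈0 = trans (+-cong (+-cong (+-cong (+-cong
        (*-cong refl (pow-cong 4 x≈0))
        (*-cong refl (*-cong (pow-cong 3 x≈0) z≈0)))
        (*-cong refl (*-cong (pow-cong 2 x≈0) (pow-cong 2 z≈0))))
        (*-cong refl (*-cong x≈0 (pow-cong 3 z≈0))))
        (*-cong refl (pow-cong 4 z≈0)))
      (solve 5 (λ A B C D E → quarticᴾ A B C D E (con 0) (con 0) := con 0) refl a b c' d e)

    on-curve-origin : ∀ {x y z} → x ≈ 0# → z ≈ 0# → OnCurve x y z → y ≈ 0#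
    on-curve-origin {x} {y} {z} x≈0 z≈0 on-curve = y*y≈0⇒y≈0 (begin
      y * y                        ≈⟨ +-identityʳ (y * y) ⟨
      y * y + 0#                   ≈⟨ +-cong refl (trans (*-cong (evalP-origin x≈0 z≈0) refl) (zeroˡ y)) ⟨
      y * y + evalP F Φ x z * y    ≈⟨ on-curve ⟩
      evalQ F Φ x z                ≈⟨ evalQ-origin x≈0 z≈0 ⟩
      0#                           ∎)

    module _ {x z} (x≥0 : Integral x) (z≥0 : Integral z) where

      evalP-v≥1 : evalP F Φ x z v≥ 1
      evalP-v≥1 = v≥-+ (v≥-+ (v≥-* vl (v≥-* x≥0 x≥0)) (v≥-* vm (v≥-* x≥0 z≥0)))
                       (v≥-weaken 1 (v≥-* vn (v≥-* z≥0 z≥0)))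

      evalQ-v≥1 : evalQ F Φ x z v≥ 1
      evalQ-v≥1 = v≥-cong (sym (sumˡ≈sum (quartic-monomials x z))) (sum-v≥
        ( v≥-* (v=⇒v≥ va) (v≥-pow 4 x≥0)
        ∷ v≥-weaken 1 (v≥-* vb (v≥-* (v≥-pow 3 x≥0) z≥0))
        ∷ v≥-weaken 1 (v≥-* vc (v≥-* (v≥-pow 2 x≥0) (v≥-pow 2 z≥0)))
        ∷ v≥-weaken 1 (v≥-* vd (v≥-* x≥0 (v≥-pow 3 z≥0)))
        ∷ v≥-weaken 1 (v≥-* (v=⇒v≥ ve) (v≥-pow 4 z≥0))
        ∷ []))

    module QuarticDescent {x y z} (x≥0 : Integral x) (y≥0 : Integral y) (z≥0 : Integral z)
                          (on-curve : OnCurve x y z) where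

      monomials-v≥ : ∀ {n} → (y * y + evalP F Φ x z * y) v≥ n → sum (quartic-monomials x z) v≥ n
      monomials-v≥ = v≥-cong (trans on-curve (sumˡ≈sum (quartic-monomials x z)))

      y*y≈y² : y * y ≈ pow y 2
      y*y≈y² = *-cong refl (sym (*-identityʳ y))

      y∈πO : y v≥ 1
      y∈πO = v≥-pow-root 1 y≥0 (v≥-cong y*y≈y²
        (v≥-cancelʳ (v≥-cong (sym on-curve) (evalQ-v≥1 x≥0 z≥0)) (v≥-* (evalP-v≥1 x≥0 z≥0) y≥0)))

      x∈πO : x v≥ 1
      x∈πO = v≥-pow-root 3 x≥0 (v≥-*-cancelˡ va
        (v≥-isolate (quartic-monomials x z) (here ≡.refl)
          (monomials-v≥ (v≥-+ (v≥-* y∈πO y∈πO) (v≥-weaken 2 (v≥-* (evalP-v≥1 x≥0 z≥0) y∈πO))))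
          ( v≥-weaken 2 (v≥-* vb (v≥-* (v≥-pow 3 x≥0) z≥0))
          ∷ v≥-weaken 2 (v≥-* vc (v≥-* (v≥-pow 2 x≥0) (v≥-pow 2 z≥0)))
          ∷ v≥-weaken 2 (v≥-* vd (v≥-* x≥0 (v≥-pow 3 z≥0)))
          ∷ v≥-weaken 2 (v≥-* (v=⇒v≥ ve) (v≥-pow 4 z≥0))
          ∷ [])))

      evalP-v≥2 : evalP F Φ x z v≥ 2
      evalP-v≥2 = v≥-+ (v≥-+ (v≥-weaken 2 (v≥-* vl (v≥-* x∈πO x∈πO))) (v≥-* vm (v≥-* x∈πO z≥0)))
                       (v≥-* vn (v≥-* z≥0 z≥0))

      y∈π²O : y v≥ 2
      y∈π²O = v≥-pow-root 1 y∈πO (v≥-cong y*y≈y²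
        (v≥-cancelʳ (v≥-cong (sym (trans on-curve (sumˡ≈sum (quartic-monomials x z)))) (sum-v≥
            ( v≥-weaken 3 (v≥-* (v=⇒v≥ va) (v≥-pow 4 x∈πO))
            ∷ v≥-weaken 3 (v≥-* vb (v≥-* (v≥-pow 3 x∈πO) z≥0))
            ∷ v≥-weaken 3 (v≥-* vc (v≥-* (v≥-pow 2 x∈πO) (v≥-pow 2 z≥0)))
            ∷ v≥-weaken 3 (v≥-* vd (v≥-* x∈πO (v≥-pow 3 z≥0)))
            ∷ v≥-* (v=⇒v≥ ve) (v≥-pow 4 z≥0)
            ∷ [])))
          (v≥-* evalP-v≥2 y∈πO)))

      z∈πO : z v≥ 1
      z∈πO = v≥-pow-root 3 z≥0 (v≥-*-cancelˡ ve
        (v≥-isolate (quartic-monomials x z) (there (there (there (there (here ≡.refl)))))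
          (monomials-v≥ (v≥-+ (v≥-* y∈π²O y∈π²O) (v≥-* evalP-v≥2 y∈π²O)))
          ( v≥-weaken 4 (v≥-* (v=⇒v≥ va) (v≥-pow 4 x∈πO))
          ∷ v≥-weaken 4 (v≥-* vb (v≥-* (v≥-pow 3 x∈πO) z≥0))
          ∷ v≥-* vc (v≥-* (v≥-pow 2 x∈πO) (v≥-pow 2 z≥0))
          ∷ v≥-* vd (v≥-* x∈πO (v≥-pow 3 z≥0))
          ∷ [])))

    critical2-no-point : ¬ HasPoint2 F Φ
    critical2-no-point (x , y , z , xyz≉0 , on-curve)
      with primitive-multiple (x ∷ z ∷ [])
             (λ { (x≈0 ∷ z≈0 ∷ []) → xyz≉0 (x≈0 , on-curve-origin x≈0 z≈0 on-curve , z≈0) })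
    ... | w , (xw≥0 ∷ zw≥0 ∷ []) , ¬all≥1 = ¬all≥1 (x∈πO ∷ z∈πO ∷ [])
      where
      scaled : OnCurve (x * w) (y * (w * w)) (z * w)
      scaled = on-curve-homogeneous w on-curve
      yw²≥0 : Integral (y * (w * w))
      yw²≥0 = monic-root-integral (v≥-weaken 0 (evalP-v≥1 xw≥0 zw≥0))
                                  (v≥-weaken 0 (evalQ-v≥1 xw≥0 zw≥0)) scaled
      open QuarticDescent xw≥0 yw²≥0 zw≥0 scaled

  -- Degree 4

  open ResidueField

  module _ (G : QuadForm F) where
    open QuadForm G

    mixed : Carrier → Carrier → Carrier → Carrier → Carrier
    mixed x₁ x₂ x₃ x₄ = q13 * (x₁ * x₃) + q14 * (x₁ * x₄) + q23 * (x₂ * x₃) + q24 * (x₂ * x₄)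

    evalQF-split : ∀ x₁ x₂ x₃ x₄ → evalQF F G x₁ x₂ x₃ x₄ ≈
      binary q11 q12 q22 x₁ x₂ + mixed x₁ x₂ x₃ x₄ + binary q33 q34 q44 x₃ x₄
    evalQF-split = solve 14
      (λ a₁₁ a₁₂ a₁₃ a₁₄ a₂₂ a₂₃ a₂₄ a₃₃ a₃₄ a₄₄ X₁ X₂ X₃ X₄ →
        quadraticᴾ a₁₁ a₁₂ a₁₃ a₁₄ a₂₂ a₂₃ a₂₄ a₃₃ a₃₄ a₄₄ X₁ X₂ X₃ X₄
          := binaryᴾ a₁₁ a₁₂ a₂₂ X₁ X₂ :+ mixedᴾ a₁₃ a₁₄ a₂₃ a₂₄ X₁ X₂ X₃ X₄ :+ binaryᴾ a₃₃ a₃₄ a₄₄ X₃ X₄)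
      refl q11 q12 q13 q14 q22 q23 q24 q33 q34 q44

    evalQF-homogeneous : ∀ x₁ x₂ x₃ x₄ w →
      evalQF F G (x₁ * w) (x₂ * w) (x₃ * w) (x₄ * w) ≈ (w * w) * evalQF F G x₁ x₂ x₃ x₄
    evalQF-homogeneous = solve 15
      (λ a₁₁ a₁₂ a₁₃ a₁₄ a₂₂ a₂₃ a₂₄ a₃₃ a₃₄ a₄₄ X₁ X₂ X₃ X₄ W →
        quadraticᴾ a₁₁ a₁₂ a₁₃ a₁₄ a₂₂ a₂₃ a₂₄ a₃₃ a₃₄ a₄₄ (X₁ :* W) (X₂ :* W) (X₃ :* W) (X₄ :* W)
          := (W :* W) :* quadraticᴾ a₁₁ a₁₂ a₁₃ a₁₄ a₂₂ a₂₃ a₂₄ a₃₃ a₃₄ a₄₄ X₁ X₂ X₃ X₄)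
      refl q11 q12 q13 q14 q22 q23 q24 q33 q34 q44

    evalQF-rescale : ∀ x₁ x₂ x₃ x₄ →
      π * evalQF F (rescale F G) (x₁ * π⁻¹) (x₂ * π⁻¹) x₃ x₄ ≈ evalQF F G x₁ x₂ x₃ x₄
    evalQF-rescale x₁ x₂ x₃ x₄ = begin
      π * evalQF F (rescale F G) (x₁ * π⁻¹) (x₂ * π⁻¹) x₃ x₄
        ≈⟨ solve 16
             (λ a₁₁ a₁₂ a₁₃ a₁₄ a₂₂ a₂₃ a₂₄ a₃₃ a₃₄ a₄₄ X₁ X₂ X₃ X₄ Π Π⁻¹ →
               Π :* quadraticᴾ (Π :* a₁₁) (Π :* a₁₂) a₁₃ a₁₄ (Π :* a₂₂) a₂₃ a₂₄
                               (Π⁻¹ :* a₃₃) (Π⁻¹ :* a₃₄) (Π⁻¹ :* a₄₄) (X₁ :* Π⁻¹) (X₂ :* Π⁻¹) X₃ X₄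
                 := (Π :* Π⁻¹) :* (Π :* Π⁻¹) :* binaryᴾ a₁₁ a₁₂ a₂₂ X₁ X₂
                    :+ (Π :* Π⁻¹) :* mixedᴾ a₁₃ a₁₄ a₂₃ a₂₄ X₁ X₂ X₃ X₄
                    :+ (Π :* Π⁻¹) :* binaryᴾ a₃₃ a₃₄ a₄₄ X₃ X₄)
             refl q11 q12 q13 q14 q22 q23 q24 q33 q34 q44 x₁ x₂ x₃ x₄ π π⁻¹ ⟩
      (π * π⁻¹) * (π * π⁻¹) * B₁₂ + (π * π⁻¹) * M + (π * π⁻¹) * B₃₄
        ≈⟨ +-cong (+-cong (*-cong (*-cong ππ⁻¹≈1 ππ⁻¹≈1) refl) (*-cong ππ⁻¹≈1 refl)) (*-cong ππ⁻¹≈1 refl) ⟩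
      1# * 1# * B₁₂ + 1# * M + 1# * B₃₄
        ≈⟨ +-cong (+-cong (trans (*-cong (*-identityˡ 1#) refl) (*-identityˡ B₁₂)) (*-identityˡ M))
                  (*-identityˡ B₃₄) ⟩
      B₁₂ + M + B₃₄
        ≈⟨ evalQF-split x₁ x₂ x₃ x₄ ⟨
      evalQF F G x₁ x₂ x₃ x₄
        ∎
      where
      B₁₂ B₃₄ M : Carrier
      B₁₂ = binary q11 q12 q22 x₁ x₂
      B₃₄ = binary q33 q34 q44 x₃ x₄
      M   = mixed x₁ x₂ x₃ x₄
      ππ⁻¹≈1 : π * π⁻¹ ≈ 1#
      ππ⁻¹≈1 = proj₂ (inverse π π≉0)

    module _ {x₁ x₂ x₃ x₄} (x₁≥0 : Integral x₁) (x₂≥0 : Integral x₂)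
             (x₃≥0 : Integral x₃) (x₄≥0 : Integral x₄)
             (G≈0 : evalQF F G x₁ x₂ x₃ x₄ ≈ 0#) where

      G-v≥1 : (binary q11 q12 q22 x₁ x₂ + mixed x₁ x₂ x₃ x₄ + binary q33 q34 q44 x₃ x₄) v≥ 1
      G-v≥1 = v≥-cong (evalQF-split x₁ x₂ x₃ x₄) (≈0⇒v≥ 1 G≈0)

      reduction₁₂ : IntegralQF F G → RedIn12 F G →
        reduce q11 *ₒ (reduce x₁ *ₒ reduce x₁) +ₒ reduce q12 *ₒ (reduce x₁ *ₒ reduce x₂)
          +ₒ reduce q22 *ₒ (reduce x₂ *ₒ reduce x₂) ≋ 0ₒ
      reduction₁₂ (i11 , i12 , _ , _ , i22 , _) (r13 , r14 , r23 , r24 , r33 , r34 , r44) =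
        reduce-binary i11 i12 i22 x₁≥0 x₂≥0 (v≥-cancelʳ (v≥-cancelʳ G-v≥1 binary₃₄-v≥1) mixed-v≥1)
        where
        mixed-v≥1 : mixed x₁ x₂ x₃ x₄ v≥ 1
        mixed-v≥1 = v≥-+ (v≥-+ (v≥-+ (v≥-* r13 (v≥-* x₁≥0 x₃≥0)) (v≥-* r14 (v≥-* x₁≥0 x₄≥0)))
                                (v≥-* r23 (v≥-* x₂≥0 x₃≥0))) (v≥-* r24 (v≥-* x₂≥0 x₄≥0))
        binary₃₄-v≥1 : binary q33 q34 q44 x₃ x₄ v≥ 1
        binary₃₄-v≥1 = v≥-+ (v≥-+ (v≥-* r33 (v≥-* x₃≥0 x₃≥0)) (v≥-* r34 (v≥-* x₃≥0 x₄≥0)))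
                            (v≥-* r44 (v≥-* x₄≥0 x₄≥0))

      reduction₃₄ : IntegralQF F G → RedIn34 F G →
        reduce q33 *ₒ (reduce x₃ *ₒ reduce x₃) +ₒ reduce q34 *ₒ (reduce x₃ *ₒ reduce x₄)
          +ₒ reduce q44 *ₒ (reduce x₄ *ₒ reduce x₄) ≋ 0ₒ
      reduction₃₄ (_ , _ , _ , _ , _ , _ , _ , i33 , i34 , i44) (r11 , r12 , r13 , r14 , r22 , r23 , r24) =
        reduce-binary i33 i34 i44 x₃≥0 x₄≥0 (v≥-cancelˡ G-v≥1 (v≥-+ binary₁₂-v≥1 mixed-v≥1))
        where
        binary₁₂-v≥1 : binary q11 q12 q22 x₁ x₂ v≥ 1
        binary₁₂-v≥1 = v≥-+ (v≥-+ (v≥-* r11 (v≥-* x₁≥0 x₁≥0)) (v≥-* r12 (v≥-* x₁≥0 x₂≥0)))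
                            (v≥-* r22 (v≥-* x₂≥0 x₂≥0))
        mixed-v≥1 : mixed x₁ x₂ x₃ x₄ v≥ 1
        mixed-v≥1 = v≥-+ (v≥-+ (v≥-+ (v≥-* r13 (v≥-* x₁≥0 x₃≥0)) (v≥-* r14 (v≥-* x₁≥0 x₄≥0)))
                                (v≥-* r23 (v≥-* x₂≥0 x₃≥0))) (v≥-* r24 (v≥-* x₂≥0 x₄≥0))

  module _ (Φ : Model4 F) (critical : Critical4 F Φ) where
    open Model4 Φ
    open Critical4 critical

    no-primitive-common-zero : ∀ {x₁ x₂ x₃ x₄} → Primitive (x₁ ∷ x₂ ∷ x₃ ∷ x₄ ∷ []) →
      evalQF F Q₁ x₁ x₂ x₃ x₄ ≈ 0# → evalQF F Q₂ x₁ x₂ x₃ x₄ ≈ 0# → ⊥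
    no-primitive-common-zero {x₁} {x₂} {x₃} {x₄} (x₁≥0 ∷ x₂≥0 ∷ x₃≥0 ∷ x₄≥0 ∷ [] , ¬all≥1) Q₁≈0 Q₂≈0
      with (x₁ v≥? 1) ×-dec (x₂ v≥? 1)
    ... | no ¬x₁₂≥1 =
      noRootQ residueExtension (reduce x₁) (reduce x₂) (reduce-nonzero x₁≥0 x₂≥0 ¬x₁₂≥1)
        (reduction₁₂ Q₁ x₁≥0 x₂≥0 x₃≥0 x₄≥0 Q₁≈0 int₁ red₁)
        (reduction₁₂ Q₂ x₁≥0 x₂≥0 x₃≥0 x₄≥0 Q₂≈0 int₂ red₂)
    ... | yes (x₁≥1 , x₂≥1) =
      noRootR residueExtension (reduce x₃) (reduce x₄)
        (reduce-nonzero x₃≥0 x₄≥0 λ (x₃≥1 , x₄≥1) → ¬all≥1 (x₁≥1 ∷ x₂≥1 ∷ x₃≥1 ∷ x₄≥1 ∷ []))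
        (reduction₃₄ R₁ y₁≥0 y₂≥0 x₃≥0 x₄≥0 (rescaled-zero Q₁ Q₁≈0) intR₁ redR₁)
        (reduction₃₄ R₂ y₁≥0 y₂≥0 x₃≥0 x₄≥0 (rescaled-zero Q₂ Q₂≈0) intR₂ redR₂)
      where
      divide-by-π : ∀ {x} → x v≥ 1 → Integral (x * π⁻¹)
      divide-by-π {x} x≥1 = integral-*-inverse (proj₂ (inverse π π≉0)) (≡.subst (_≤∞ v x) (≡.sym v-π) x≥1)
      y₁≥0 : Integral (x₁ * π⁻¹)
      y₁≥0 = divide-by-π x₁≥1
      y₂≥0 : Integral (x₂ * π⁻¹)
      y₂≥0 = divide-by-π x₂≥1
      rescaled-zero : ∀ G → evalQF F G x₁ x₂ x₃ x₄ ≈ 0# →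
        evalQF F (rescale F G) (x₁ * π⁻¹) (x₂ * π⁻¹) x₃ x₄ ≈ 0#
      rescaled-zero G G≈0 = x*y≈0⇒y≈0 π≉0 (trans (evalQF-rescale G x₁ x₂ x₃ x₄) G≈0)

    critical4-no-point : ¬ HasPoint4 F Φ
    critical4-no-point (x₁ , x₂ , x₃ , x₄ , x≉0 , Q₁≈0 , Q₂≈0)
      with primitive-multiple (x₁ ∷ x₂ ∷ x₃ ∷ x₄ ∷ [])
             (λ { (x₁≈0 ∷ x₂≈0 ∷ x₃≈0 ∷ x₄≈0 ∷ []) → x≉0 (x₁≈0 , x₂≈0 , x₃≈0 , x₄≈0) })
    ... | w , xw-primitive =
      no-primitive-common-zero xw-primitive (scaled-zero Q₁ Q₁≈0) (scaled-zero Q₂ Q₂≈0)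
      where
      scaled-zero : ∀ G → evalQF F G x₁ x₂ x₃ x₄ ≈ 0# →
        evalQF F G (x₁ * w) (x₂ * w) (x₃ * w) (x₄ * w) ≈ 0#
      scaled-zero G G≈0 =
        trans (evalQF-homogeneous G x₁ x₂ x₃ x₄ w) (trans (*-cong refl G≈0) (zeroʳ (w * w)))

lemma5p2 : {c ℓ : Level} (F : DVField c ℓ) → PerfectResidueField F →
    (n : ℕ) → 2 ≤ n → n ≤ 4 → (Φ : Model F n) → Critical F n Φ →
    ¬ HasKPoint F n Φ
lemma5p2 F _ 2 _ _ Φ (lift critical) = critical2-no-point F Φ critical
lemma5p2 F _ 3 _ _ Φ (lift critical) = critical3-no-point F Φ critical
lemma5p2 F _ 4 _ _ Φ critical        = critical4-no-point F Φ critical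
lemma5p2 F _ 0 () _ _ _
lemma5p2 F _ 1 (s≤s ()) _ _ _
lemma5p2 F _ (suc (suc (suc (suc (suc _))))) _ (s≤s (s≤s (s≤s (s≤s ())))) _ _
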